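{- If $a$ is any binary sequence of length $4$, then $a\odot M_V^*$ represents the same configuration as one of the matrices $M_{IV}$, $\overline{M_{IV}}$, $M_V^*$, $\overline{M_V^*}$. Conversely, each of $M_{IV}$, $\overline{M_{IV}}$, $M_V^*$, $\overline{M_V^*}$ represents the same configuration as $a\odot M_V^*$ for some binary sequence $a$ of length $4$. Moreover, these four matrices represent pairwise different configurations.
   Context: Two binary matrices represent the same configuration if they are equal up to permutations of rows and of columns. $\overline M$ exchanges $0$'s and $1$'s of $M$. $M^*$ is $M$ with a last all-zero column appended. For a binary sequence $a=a_1\dots a_k$ and a $k$-row matrix $M$, $a\odot M$ is obtained by complementing each row $i$ with $a_i=1$. $M_{IV}$ is the $4\times 6$ matrix with rows $(1,1,0,0,0,0),(0,0,1,1,0,0),(0,0,0,0,1,1),(0,1,0,1,0,1)$; $M_V$ is the $4\times 5$ matrix with rows $(1,1,0,0,0),(1,1,1,1,0),(0,0,1,1,0),(1,0,0,1,1)$. -}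

module Defs where

open import Data.Nat using (ℕ)
open import Data.Bool using (Bool; true; false; not; if_then_else_)
open import Data.Fin using (Fin; zero; suc)
open import Data.Fin.Permutation using (Permutation′; _⟨$⟩ʳ_)
open import Data.Product using (Σ; ∃; ∃-syntax; _×_)
open import Data.Vec using (Vec; []; _∷_; lookup)
open import Relation.Binary.PropositionalEquality using (_≡_)

BMat : ℕ → ℕ → Set
BMat m n = Fin m → Fin n → Bool

fromRows : ∀ {m n} → Vec (Vec Bool n) m → BMat m n
fromRows rs i j = lookup (lookup rs i) j

SameConfig : ∀ {m n} → BMat m n → BMat m n → Set
SameConfig {m} {n} M N =
  Σ (Permutation′ m) λ σ → Σ (Permutation′ n) λ τ → (∀ (i : Fin m) (j : Fin n) →
    M i j ≡ N (σ ⟨$⟩ʳ i) (τ ⟨$⟩ʳ j))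

compl : ∀ {m n} → BMat m n → BMat m n
compl M i j = not (M i j)

-- M* : append an all-zero last column
star : ∀ {m n} → BMat m n → BMat m (ℕ.suc n)
star {n = ℕ.zero} M i zero = false
star {n = ℕ.suc n} M i zero = M i zero
star {n = ℕ.suc n} M i (suc j) = star (λ i' j' → M i' (suc j')) i j

_⊙_ : ∀ {m n} → (Fin m → Bool) → BMat m n → BMat m n
(a ⊙ M) i j = if a i then not (M i j) else M i j

private
  0b 1b : Bool
  0b = false
  1b = true

M-IV : BMat 4 6
M-IV = fromRows
  ( (1b ∷ 1b ∷ 0b ∷ 0b ∷ 0b ∷ 0b ∷ [])
  ∷ (0b ∷ 0b ∷ 1b ∷ 1b ∷ 0b ∷ 0b ∷ [])
  ∷ (0b ∷ 0b ∷ 0b ∷ 0b ∷ 1b ∷ 1b ∷ [])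
  ∷ (0b ∷ 1b ∷ 0b ∷ 1b ∷ 0b ∷ 1b ∷ [])
  ∷ [])

M-V : BMat 4 5
M-V = fromRows
  ( (1b ∷ 1b ∷ 0b ∷ 0b ∷ 0b ∷ [])
  ∷ (1b ∷ 1b ∷ 1b ∷ 1b ∷ 0b ∷ [])
  ∷ (0b ∷ 0b ∷ 1b ∷ 1b ∷ 0b ∷ [])
  ∷ (1b ∷ 0b ∷ 0b ∷ 1b ∷ 1b ∷ [])
  ∷ [])

M-V* : BMat 4 6
M-V* = star M-V

-- Flipping all rows of a matrix is complementation, and the four target
-- configurations are closed under complementation, so it suffices to
-- classify the eight sign patterns a with a₁ = 0; each is matched to a
-- target by an explicit pair of row and column permutations.  The four
-- targets are told apart by their sets of column weights, which are
-- invariant under row and column permutations.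
module Submission where

open import Defs
open import Algebra.Properties.CommutativeMonoid.Sum as Sum using ()
open import Data.Bool using (Bool; true; false; not; if_then_else_)
open import Data.Bool.Properties using (not-involutive) renaming (_≟_ to _≟ᵇ_)
open import Data.Fin using (Fin; suc)
open import Data.Fin.Patterns using (0F; 1F; 2F; 3F; 4F; 5F)
open import Data.Fin.Permutation
  using (Permutation′; _⟨$⟩ʳ_; _⟨$⟩ˡ_; inverseʳ; id; flip; transpose; reverse; _∘ₚ_)
open import Data.Fin.Properties using (all?; any?)
open import Data.Nat using (ℕ)
open import Data.Nat.Properties using (+-0-commutativeMonoid; _≟_)
open import Data.Product using (_×_; ∃-syntax; _,_)
open import Data.Sum using (_⊎_; inj₁; inj₂)
open import Data.Vec using (Vec; []; _∷_; lookup; tabulate; map)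
open import Data.Vec.Properties using (lookup∘tabulate; lookup-map)
open import Function using (_∘_)
open import Relation.Binary.PropositionalEquality
  using (_≡_; _≢_; _≗_; refl; sym; trans; cong; cong₂)
open import Relation.Nullary using (¬_; Dec; ¬?)
open import Relation.Nullary.Decidable using (True; toWitness)

open Sum +-0-commutativeMonoid using (sum; sum-permute; sum-cong-≗)

private
  variable
    m n : ℕ

infix 4 _≐_ _≐?_

_≐_ : BMat m n → BMat m n → Set
M ≐ N = ∀ i j → M i j ≡ N i j

_≐?_ : (M N : BMat m n) → Dec (M ≐ N)
M ≐? N = all? λ i → all? λ j → M i j ≟ᵇ N i j

reindex : Permutation′ m → Permutation′ n → BMat m n → BMat m n
reindex σ τ N i j = N (σ ⟨$⟩ʳ i) (τ ⟨$⟩ʳ j)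

sameConfig : ∀ {M : BMat m n} N σ τ → {True (M ≐? reindex σ τ N)} → SameConfig M N
sameConfig N σ τ {M≐σ∘N∘τ} = σ , τ , toWitness M≐σ∘N∘τ

SameConfig-sym : {M N : BMat m n} → SameConfig M N → SameConfig N M
SameConfig-sym {N = N} (σ , τ , M≐σ∘N∘τ) = flip σ , flip τ , λ i j →
  sym (trans (M≐σ∘N∘τ (σ ⟨$⟩ˡ i) (τ ⟨$⟩ˡ j)) (cong₂ N (inverseʳ σ) (inverseʳ τ)))

SameConfig-respˡ : {M M′ N : BMat m n} → M ≐ M′ → SameConfig M N → SameConfig M′ N
SameConfig-respˡ M≐M′ (σ , τ , M≐σ∘N∘τ) = σ , τ , λ i j → trans (sym (M≐M′ i j)) (M≐σ∘N∘τ i j)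

SameConfig-respʳ : {M N N′ : BMat m n} → N ≐ N′ → SameConfig M N → SameConfig M N′
SameConfig-respʳ N≐N′ (σ , τ , M≐σ∘N∘τ) = σ , τ , λ i j →
  trans (M≐σ∘N∘τ i j) (N≐N′ (σ ⟨$⟩ʳ i) (τ ⟨$⟩ʳ j))

SameConfig-compl : {M N : BMat m n} → SameConfig M N → SameConfig (compl M) (compl N)
SameConfig-compl (σ , τ , M≐σ∘N∘τ) = σ , τ , λ i j → cong not (M≐σ∘N∘τ i j)

compl-involutive : (M : BMat m n) → compl (compl M) ≐ M
compl-involutive M i j = not-involutive (M i j)

compl-⊙ : (a : Fin m → Bool) (M : BMat m n) → compl (a ⊙ M) ≐ (not ∘ a) ⊙ M
compl-⊙ a M i j with a i
... | true  = not-involutive (M i j)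
... | false = refl

⊙-cong : {a b : Fin m → Bool} → a ≗ b → (M : BMat m n) → a ⊙ M ≐ b ⊙ M
⊙-cong a≗b M i j rewrite a≗b i = refl

weight : (Fin n → Bool) → ℕ
weight v = sum λ j → if v j then 1 else 0

columnWeight : BMat m n → Fin n → ℕ
columnWeight M j = weight λ i → M i j

columnWeight-reindex : ∀ σ τ (N : BMat m n) j →
  columnWeight (reindex σ τ N) j ≡ columnWeight N (τ ⟨$⟩ʳ j)
columnWeight-reindex σ τ N j = sym (sum-permute (λ i → if N i (τ ⟨$⟩ʳ j) then 1 else 0) σ)

SameConfig⇒columnWeight : {M N : BMat m n} → SameConfig M N →
  ∀ j → ∃[ k ] columnWeight M j ≡ columnWeight N k
SameConfig⇒columnWeight {N = N} (σ , τ , M≐σ∘N∘τ) j = τ ⟨$⟩ʳ j , trans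
  (sum-cong-≗ λ i → cong (λ b → if b then 1 else 0) (M≐σ∘N∘τ i j))
  (columnWeight-reindex σ τ N j)

NewColumnWeight : BMat m n → BMat m n → Set
NewColumnWeight M N = ∃[ j ] ∀ k → columnWeight M j ≢ columnWeight N k

newColumnWeight? : (M N : BMat m n) → Dec (NewColumnWeight M N)
newColumnWeight? M N = any? λ j → all? λ k → ¬? (columnWeight M j ≟ columnWeight N k)

≁-byColumnWeightˡ : (M N : BMat m n) {new : True (newColumnWeight? M N)} → ¬ SameConfig M N
≁-byColumnWeightˡ M N {new} M∼N with toWitness new
... | j , j-new with SameConfig⇒columnWeight M∼N j
...   | k , weights≡ = j-new k weights≡

≁-byColumnWeightʳ : (M N : BMat m n) {new : True (newColumnWeight? N M)} → ¬ SameConfig M N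
≁-byColumnWeightʳ M N {new} = ≁-byColumnWeightˡ N M {new} ∘ SameConfig-sym

OneOfFour : BMat 4 6 → Set
OneOfFour M = SameConfig M M-IV ⊎ SameConfig M (compl M-IV)
            ⊎ SameConfig M M-V* ⊎ SameConfig M (compl M-V*)

OneOfFour-respˡ : {M M′ : BMat 4 6} → M ≐ M′ → OneOfFour M → OneOfFour M′
OneOfFour-respˡ M≐M′ (inj₁ c) = inj₁ (SameConfig-respˡ {N = M-IV} M≐M′ c)
OneOfFour-respˡ M≐M′ (inj₂ (inj₁ c)) = inj₂ (inj₁ (SameConfig-respˡ {N = compl M-IV} M≐M′ c))
OneOfFour-respˡ M≐M′ (inj₂ (inj₂ (inj₁ c))) =
  inj₂ (inj₂ (inj₁ (SameConfig-respˡ {N = M-V*} M≐M′ c)))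
OneOfFour-respˡ M≐M′ (inj₂ (inj₂ (inj₂ c))) =
  inj₂ (inj₂ (inj₂ (SameConfig-respˡ {N = compl M-V*} M≐M′ c)))

OneOfFour-compl : {M : BMat 4 6} → OneOfFour M → OneOfFour (compl M)
OneOfFour-compl (inj₁ c) = inj₂ (inj₁ (SameConfig-compl {N = M-IV} c))
OneOfFour-compl (inj₂ (inj₁ c)) =
  inj₁ (SameConfig-respʳ (compl-involutive M-IV) (SameConfig-compl {N = compl M-IV} c))
OneOfFour-compl (inj₂ (inj₂ (inj₁ c))) = inj₂ (inj₂ (inj₂ (SameConfig-compl {N = M-V*} c)))
OneOfFour-compl (inj₂ (inj₂ (inj₂ c))) =
  inj₂ (inj₂ (inj₁
    (SameConfig-respʳ (compl-involutive M-V*) (SameConfig-compl {N = compl M-V*} c))))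

OneOfFour-⊙-M-V*₀ : (v : Vec Bool 3) → OneOfFour (lookup (false ∷ v) ⊙ M-V*)
OneOfFour-⊙-M-V*₀ (false ∷ false ∷ false ∷ []) =
  inj₂ (inj₂ (inj₁ (sameConfig M-V* id id)))
OneOfFour-⊙-M-V*₀ (false ∷ false ∷ true ∷ []) =
  inj₂ (inj₂ (inj₁ (sameConfig M-V* id
    (transpose 0F 1F ∘ₚ transpose 2F 3F ∘ₚ transpose 4F 5F))))
OneOfFour-⊙-M-V*₀ (false ∷ true ∷ false ∷ []) =
  inj₂ (inj₂ (inj₂ (sameConfig (compl M-V*) (transpose 0F 1F) reverse)))
OneOfFour-⊙-M-V*₀ (false ∷ true ∷ true ∷ []) =
  inj₂ (inj₂ (inj₂ (sameConfig (compl M-V*) (transpose 0F 1F)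
    (transpose 0F 4F ∘ₚ transpose 1F 5F))))
OneOfFour-⊙-M-V*₀ (true ∷ false ∷ false ∷ []) =
  inj₁ (sameConfig M-IV (transpose 1F 2F) (transpose 0F 1F ∘ₚ transpose 4F 5F))
OneOfFour-⊙-M-V*₀ (true ∷ false ∷ true ∷ []) =
  inj₁ (sameConfig M-IV (transpose 1F 2F) (transpose 2F 3F))
OneOfFour-⊙-M-V*₀ (true ∷ true ∷ false ∷ []) =
  inj₂ (inj₂ (inj₁ (sameConfig M-V* (transpose 1F 2F)
    (transpose 2F 5F ∘ₚ transpose 3F 4F))))
OneOfFour-⊙-M-V*₀ (true ∷ true ∷ true ∷ []) =
  inj₂ (inj₂ (inj₁ (sameConfig M-V* (transpose 1F 2F)
    (transpose 0F 1F ∘ₚ transpose 2F 4F ∘ₚ transpose 3F 5F))))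

compl-⊙-negated : (v : Vec Bool 3) (M : BMat 4 n) →
  compl (lookup (false ∷ map not v) ⊙ M) ≐ lookup (true ∷ v) ⊙ M
compl-⊙-negated v M i j =
  trans (compl-⊙ (lookup (false ∷ map not v)) M i j) (⊙-cong not-lookup M i j)
  where
  not-lookup : not ∘ lookup (false ∷ map not v) ≗ lookup (true ∷ v)
  not-lookup 0F = refl
  not-lookup (suc i) = trans (cong not (lookup-map i not v)) (not-involutive (lookup v i))

OneOfFour-⊙-M-V* : (a : Fin 4 → Bool) → OneOfFour (a ⊙ M-V*)
OneOfFour-⊙-M-V* a = OneOfFour-respˡ (⊙-cong (lookup∘tabulate a) M-V*) (byVector (tabulate a))
  where
  byVector : (v : Vec Bool 4) → OneOfFour (lookup v ⊙ M-V*)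
  byVector (false ∷ v) = OneOfFour-⊙-M-V*₀ v
  byVector (true ∷ v) =
    OneOfFour-respˡ (compl-⊙-negated v M-V*) (OneOfFour-compl (OneOfFour-⊙-M-V*₀ (map not v)))

realisedBy : ∀ {M} (v : Vec Bool 4) σ τ → {True (M ≐? reindex σ τ (lookup v ⊙ M-V*))} →
  ∃[ a ] SameConfig M (a ⊙ M-V*)
realisedBy v σ τ {matches} = lookup v , sameConfig (lookup v ⊙ M-V*) σ τ {matches}

lemma9 : ((a : Fin 4 → Bool) →
              SameConfig (a ⊙ M-V*) M-IV ⊎ SameConfig (a ⊙ M-V*) (compl M-IV)
              ⊎ SameConfig (a ⊙ M-V*) M-V* ⊎ SameConfig (a ⊙ M-V*) (compl M-V*))
           × ((∃[ a ] SameConfig M-IV (a ⊙ M-V*))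
              × (∃[ a ] SameConfig (compl M-IV) (a ⊙ M-V*))
              × (∃[ a ] SameConfig M-V* (a ⊙ M-V*))
              × (∃[ a ] SameConfig (compl M-V*) (a ⊙ M-V*)))
           × (¬ SameConfig M-IV (compl M-IV)
              × ¬ SameConfig M-IV M-V*
              × ¬ SameConfig M-IV (compl M-V*)
              × ¬ SameConfig (compl M-IV) M-V*
              × ¬ SameConfig (compl M-IV) (compl M-V*)
              × ¬ SameConfig M-V* (compl M-V*))
lemma9 = OneOfFour-⊙-M-V*
       , ( realisedBy (false ∷ true ∷ false ∷ false ∷ [])
             (transpose 1F 2F) (transpose 0F 1F ∘ₚ transpose 4F 5F)
         , realisedBy (true ∷ false ∷ true ∷ false ∷ []) (transpose 1F 2F) (transpose 2F 3F)
         , realisedBy (false ∷ false ∷ false ∷ false ∷ []) id id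
         , realisedBy (false ∷ false ∷ true ∷ false ∷ []) (transpose 0F 1F) reverse)
       , ( ≁-byColumnWeightˡ M-IV (compl M-IV)
         , ≁-byColumnWeightʳ M-IV M-V*
         , ≁-byColumnWeightʳ M-IV (compl M-V*)
         , ≁-byColumnWeightʳ (compl M-IV) M-V*
         , ≁-byColumnWeightʳ (compl M-IV) (compl M-V*)
         , ≁-byColumnWeightˡ M-V* (compl M-V*))
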